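{- For every positive integer $x$ and every integer $n\ge 2$, \[ \alpha^{(n)}_{\mathfrak{p}}(x)=P_{\alpha^{(n-1)}_{\mathfrak{p}}(x)}; \] equivalently, $\alpha^{(n)}_{\mathfrak{p}}(x)=P_{P_{\cdots P_x}}$, the iterated prime index.
   Context: Let $P_k$ denote the $k$th prime number ($P_1=2$, $P_2=3,\dots$). The generalized ($n$th-degree) primorial is defined by $\mathfrak{p}^{(0)}(P_k)=P_k$ and, for $n\ge 1$ and positive integers $x$, $\mathfrak{p}^{(n)}(x)=\prod_{k=1}^{x}\mathfrak{p}^{(n-1)}(P_k)$; thus $\mathfrak{p}^{(1)}(x)=P_1P_2\cdots P_x$ is the usual primorial. Let $\omega(m)$ denote the number of distinct prime factors of $m$, and define $\alpha^{(n)}_{\mathfrak{p}}(x)=\omega(\mathfrak{p}^{(n)}(x))$. -}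

module Defs where

open import Data.Nat using (ℕ; zero; suc; _+_; _*_; _!)
open import Data.Nat.Primality using (Prime; prime?)
open import Data.Nat.Divisibility using (_∣_; _∣?_)
open import Relation.Nullary using (yes; no)

-- Bounded search: first prime among p, p+1, ..., p+f-1 (returns p+f if none,
-- which never happens when used below, by Euclid's bound).
searchPrime : ℕ → ℕ → ℕ
searchPrime p zero = p
searchPrime p (suc f) with prime? p
... | yes _ = p
... | no  _ = searchPrime (suc p) f

-- Least prime strictly greater than n (for n ≥ 1): searched in n+1 .. n+n!,
-- and n!+1 ≤ n+n! always contains a prime factor exceeding n.
nextPrime : ℕ → ℕ
nextPrime n = searchPrime (suc n) (n !)

-- P k = k-th prime, 1-indexed: P 1 = 2, P 2 = 3, ...  (P 0 = 1 is a dummy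
-- value used only as the seed of the recursion).
P : ℕ → ℕ
P zero = 1
P (suc k) = nextPrime (P k)

prodFrom1 : ℕ → (ℕ → ℕ) → ℕ
prodFrom1 zero f = 1
prodFrom1 (suc x) f = prodFrom1 x f * f (suc x)

-- Generalised primorial 𝔭^(n).  𝔭^(0) is the identity (the paper defines it
-- only on primes, 𝔭^(0)(P_k) = P_k, and it is only ever applied to primes);
-- 𝔭^(n)(x) = ∏_{k=1}^{x} 𝔭^(n-1)(P_k).
genPrimorial : ℕ → ℕ → ℕ
genPrimorial zero y = y
genPrimorial (suc n) x = prodFrom1 x (λ k → genPrimorial n (P k))

countPrimeDivisorsUpTo : ℕ → ℕ → ℕ
countPrimeDivisorsUpTo zero m = 0
countPrimeDivisorsUpTo (suc d) m with prime? (suc d) | suc d ∣? m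
... | yes _ | yes _ = suc (countPrimeDivisorsUpTo d m)
... | _     | _     = countPrimeDivisorsUpTo d m

-- ω(m): number of distinct prime factors of m (meaningful for m ≥ 1)
ω : ℕ → ℕ
ω m = countPrimeDivisorsUpTo m m

α : ℕ → ℕ → ℕ
α n x = ω (genPrimorial n x)

-- Write Pᵐ for the m-fold iterate of P.  The prime divisors of 𝔭^(1)(x) are
-- P 1, …, P x, i.e. exactly the primes ≤ P x, and since 𝔭^(m+2)(x) is the
-- product of the 𝔭^(m+1)(P k) for k ≤ x, induction on m shows that the prime
-- divisors of 𝔭^(m+1)(x) are exactly the primes ≤ P (Pᵐ x).  Counting them,
-- α^(m+1)(x) = Pᵐ x, so α^(m+2)(x) = Pᵐ⁺¹ x = P (α^(m+1)(x)).
module Submission where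

open import Defs
open import Data.List.Base using ([]; _∷_)
open import Data.List.Relation.Unary.All using (_∷_)
open import Data.Nat.Base
open import Data.Nat.Divisibility
open import Data.Nat.GeneralisedArithmetic using (iterate)
open import Data.Nat.ListAction using (product)
open import Data.Nat.Primality
open import Data.Nat.Primality.Factorisation using (factorise)
open import Data.Nat.Properties
open import Data.Product using (∃-syntax; _×_; _,_)
open import Data.Sum using (inj₁; inj₂)
open import Function.Bundles using (_⇔_; mk⇔; Equivalence)
open import Relation.Nullary using (¬_; yes; no)
open import Relation.Nullary.Negation using (contradiction)
open import Relation.Binary.PropositionalEquality using (_≡_; refl; sym; trans; cong; subst; module ≡-Reasoning)

open Equivalence using (to; from)

private
  variable
    a b k m n p q r x B : ℕ

prime⇒≥2 : Prime p → 2 ≤ p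
prime⇒≥2 {p} pp = nonTrivial⇒n>1 p {{prime⇒nonTrivial pp}}

prime∣prime⇒≡ : Prime p → Prime q → p ∣ q → p ≡ q
prime∣prime⇒≡ pp pq p∣q with prime⇒irreducible pq p∣q
... | inj₁ refl = contradiction pp ¬prime[1]
... | inj₂ p≡q  = p≡q

∃prime∣ : ∀ n → 2 ≤ n → ∃[ p ] Prime p × p ∣ n
∃prime∣ n 2≤n with factorise n {{>-nonZero (<⇒≤ 2≤n)}}
... | record { factors = [] ; isFactorisation = n≡1 } =
  contradiction (subst (2 ≤_) n≡1 2≤n) λ { (s≤s ()) }
... | record { factors = p ∷ ps ; isFactorisation = n≡p*ps ; factorsPrime = pp ∷ _ } =
  p , pp , divides (product ps) (trans n≡p*ps (*-comm p (product ps)))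

1≤m≤n⇒m∣n! : 1 ≤ m → m ≤ n → m ∣ n !
1≤m≤n⇒m∣n! {suc m} _ 1+m≤n = ∣-trans (m∣m*n (m !)) (m≤n⇒m!∣n! 1+m≤n)

-- Euclid: a prime factor of n ! + 1 cannot divide n !, so it exceeds n.
∃prime>n∧≤n!+1 : ∀ n → ∃[ q ] Prime q × n < q × q ≤ n ! + 1
∃prime>n∧≤n!+1 n with ∃prime∣ (n ! + 1) (+-monoˡ-≤ 1 (1≤n! n))
... | q , pq , q∣n!+1 = q , pq , n<q , ∣⇒≤ {{>-nonZero (m≤n+m 1 (n !))}} q∣n!+1
  where
  n<q : n < q
  n<q = ≰⇒> λ q≤n → contradiction
    (subst Prime (∣1⇒≡1 (∣m+n∣m⇒∣n q∣n!+1 (1≤m≤n⇒m∣n! (<⇒≤ (prime⇒≥2 pq)) q≤n))) pq)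
    ¬prime[1]

PrimeFree : ℕ → ℕ → Set
PrimeFree a b = ∀ {q} → a ≤ q → q < b → ¬ Prime q

LeastPrimeFrom : ℕ → ℕ → Set
LeastPrimeFrom a r = Prime r × a ≤ r × PrimeFree a r

leastPrimeFrom-suc : ¬ Prime a → LeastPrimeFrom (suc a) r → LeastPrimeFrom a r
leastPrimeFrom-suc {a} ¬pa (pr , a<r , free) = pr , <⇒≤ a<r , free′
  where
  free′ : PrimeFree a _
  free′ a≤q q<r with m≤n⇒m<n∨m≡n a≤q
  ... | inj₁ a<q  = free a<q q<r
  ... | inj₂ refl = ¬pa

searchPrime-least : ∀ a f → (∃[ q ] Prime q × a ≤ q × q < a + f) →
                    LeastPrimeFrom a (searchPrime a f)
searchPrime-least a zero (q , _ , a≤q , q<a+0) =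
  contradiction (subst (q <_) (+-identityʳ a) q<a+0) (≤⇒≯ a≤q)
searchPrime-least a (suc f) (q , pq , a≤q , q<a+1+f) with prime? a
... | yes pa  = pa , ≤-refl , λ a≤q q<a → contradiction q<a (≤⇒≯ a≤q)
... | no  ¬pa = leastPrimeFrom-suc ¬pa
  (searchPrime-least (suc a) f (q , pq , a<q , subst (q <_) (+-suc a f) q<a+1+f))
  where
  a<q : a < q
  a<q = ≤∧≢⇒< a≤q λ { refl → ¬pa pq }

nextPrime-least : 1 ≤ n → LeastPrimeFrom (suc n) (nextPrime n)
nextPrime-least {n} 1≤n with ∃prime>n∧≤n!+1 n
... | q , pq , n<q , q≤n!+1 = searchPrime-least (suc n) (n !) (q , pq , n<q , s≤s q≤n+n!)
  where
  q≤n+n! : q ≤ n + n !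
  q≤n+n! = ≤-trans q≤n!+1 (≤-trans (≤-reflexive (+-comm (n !) 1)) (+-monoˡ-≤ (n !) 1≤n))

1≤P : ∀ k → 1 ≤ P k
P-least : ∀ k → LeastPrimeFrom (suc (P k)) (P (suc k))

1≤P zero    = ≤-refl
1≤P (suc k) = let (_ , P<P′ , _) = P-least k in ≤-trans (1≤P k) (<⇒≤ P<P′)
P-least k   = nextPrime-least (1≤P k)

P-< : ∀ k → P k < P (suc k)
P-< k = let (_ , P<P′ , _) = P-least k in P<P′

P-prime : 1 ≤ k → Prime (P k)
P-prime {suc k} _ = let (pP′ , _) = P-least k in pP′

P-mono-≤ : a ≤ b → P a ≤ P b
P-mono-≤ a≤b = go (≤⇒≤′ a≤b)
  where
  go : a ≤′ b → P a ≤ P b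
  go ≤′-refl               = ≤-refl
  go (≤′-step {b} a≤b)     = ≤-trans (go a≤b) (<⇒≤ (P-< b))

prime≤P⇒≡P : ∀ x → Prime p → p ≤ P x → ∃[ k ] 1 ≤ k × k ≤ x × p ≡ P k
prime≤P⇒≡P zero pp p≤1 = contradiction p≤1 (<⇒≱ (prime⇒≥2 pp))
prime≤P⇒≡P {p} (suc x) pp p≤P′ with p ≤? P x
... | yes p≤P = let (k , 1≤k , k≤x , p≡Pk) = prime≤P⇒≡P x pp p≤P
                in k , 1≤k , m≤n⇒m≤1+n k≤x , p≡Pk
... | no  p≰P with m≤n⇒m<n∨m≡n p≤P′
...   | inj₁ p<P′ = let (_ , _ , free) = P-least x in contradiction pp (free (≰⇒> p≰P) p<P′)
...   | inj₂ p≡P′ = suc x , s≤s z≤n , ≤-refl , p≡P′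

prodFrom1-pos : ∀ x f → (∀ k → 1 ≤ f k) → 1 ≤ prodFrom1 x f
prodFrom1-pos zero    f _   = ≤-refl
prodFrom1-pos (suc x) f pos = *-mono-≤ (prodFrom1-pos x f pos) (pos (suc x))

∣prodFrom1 : ∀ x f → 1 ≤ k → k ≤ x → f k ∣ prodFrom1 x f
∣prodFrom1 zero    f 1≤k k≤0 = contradiction (≤-trans 1≤k k≤0) λ ()
∣prodFrom1 (suc x) f 1≤k k≤1+x with m≤n⇒m<n∨m≡n k≤1+x
... | inj₁ k<1+x = ∣m⇒∣m*n (f (suc x)) (∣prodFrom1 x f 1≤k (≤-pred k<1+x))
... | inj₂ refl  = n∣m*n (prodFrom1 x f)

prime∣prodFrom1 : ∀ x f → Prime p → p ∣ prodFrom1 x f → ∃[ k ] 1 ≤ k × k ≤ x × p ∣ f k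
prime∣prodFrom1 zero f pp p∣1 = contradiction (subst Prime (∣1⇒≡1 p∣1) pp) ¬prime[1]
prime∣prodFrom1 (suc x) f pp p∣∏ with euclidsLemma (prodFrom1 x f) (f (suc x)) pp p∣∏
... | inj₁ p∣∏′ = let (k , 1≤k , k≤x , p∣fk) = prime∣prodFrom1 x f pp p∣∏′
                  in k , 1≤k , m≤n⇒m≤1+n k≤x , p∣fk
... | inj₂ p∣f  = suc x , s≤s z≤n , ≤-refl , p∣f

genPrimorial-pos : ∀ n y → 1 ≤ y → 1 ≤ genPrimorial n y
genPrimorial-pos zero    y 1≤y = 1≤y
genPrimorial-pos (suc n) y _   = prodFrom1-pos y _ λ k → genPrimorial-pos n (P k) (1≤P k)

iterate-preserves : ∀ {A : Set} (Q : A → Set) {f : A → A} → (∀ {y} → Q y → Q (f y)) →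
                    ∀ {y} m → Q y → Q (iterate f y m)
iterate-preserves Q Qf zero    Qy = Qy
iterate-preserves Q Qf (suc m) Qy = iterate-preserves Q Qf m (Qf Qy)

iterate-comm : ∀ {A : Set} (f : A → A) y m → iterate f (f y) m ≡ f (iterate f y m)
iterate-comm f y zero    = refl
iterate-comm f y (suc m) = iterate-comm f (f y) m

iterate-mono-≤ : ∀ {f : ℕ → ℕ} → (∀ {a b} → a ≤ b → f a ≤ f b) →
                 ∀ m → a ≤ b → iterate f a m ≤ iterate f b m
iterate-mono-≤ mono zero    a≤b = a≤b
iterate-mono-≤ mono (suc m) a≤b = iterate-mono-≤ mono m (mono a≤b)

PrimeDivisorsUpTo : ℕ → ℕ → Set
PrimeDivisorsUpTo n B = ∀ {p} → Prime p → p ∣ n ⇔ p ≤ B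

genPrimorial-primeDivisors : ∀ m x → 1 ≤ x →
                             PrimeDivisorsUpTo (genPrimorial (suc m) x) (P (iterate P x m))
genPrimorial-primeDivisors zero x _ {p} pp = mk⇔ to′ from′
  where
  to′ : p ∣ prodFrom1 x P → p ≤ P x
  to′ p∣∏ = let (k , 1≤k , k≤x , p∣Pk) = prime∣prodFrom1 x P pp p∣∏
            in subst (_≤ P x) (sym (prime∣prime⇒≡ pp (P-prime 1≤k) p∣Pk)) (P-mono-≤ k≤x)
  from′ : p ≤ P x → p ∣ prodFrom1 x P
  from′ p≤Px = let (k , 1≤k , k≤x , p≡Pk) = prime≤P⇒≡P x pp p≤Px
               in subst (_∣ prodFrom1 x P) (sym p≡Pk) (∣prodFrom1 x P 1≤k k≤x)
genPrimorial-primeDivisors (suc m) x 1≤x {p} pp = mk⇔ to′ from′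
  where
  G : ℕ → ℕ
  G k = genPrimorial (suc m) (P k)
  to′ : p ∣ prodFrom1 x G → p ≤ P (iterate P (P x) m)
  to′ p∣∏ = let (k , 1≤k , k≤x , p∣Gk) = prime∣prodFrom1 x G pp p∣∏
            in ≤-trans (to (genPrimorial-primeDivisors m (P k) (1≤P k) pp) p∣Gk)
                       (P-mono-≤ (iterate-mono-≤ P-mono-≤ m (P-mono-≤ k≤x)))
  from′ : p ≤ P (iterate P (P x) m) → p ∣ prodFrom1 x G
  from′ p≤B = ∣-trans (from (genPrimorial-primeDivisors m (P x) (1≤P x) pp) p≤B)
                      (∣prodFrom1 x G 1≤x ≤-refl)

primeCount : ℕ → ℕ
primeCount zero = 0
primeCount (suc d) with prime? (suc d)
... | yes _ = suc (primeCount d)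
... | no  _ = primeCount d

primeCount-PrimeFree : a ≤ b → PrimeFree (suc a) (suc b) → primeCount b ≡ primeCount a
primeCount-PrimeFree {a} {b} a≤b free with m≤n⇒m<n∨m≡n a≤b
... | inj₂ refl = refl
primeCount-PrimeFree {a} {suc b} _ free | inj₁ a<1+b with prime? (suc b)
... | yes pb = contradiction pb (free a<1+b ≤-refl)
... | no  _  = primeCount-PrimeFree (≤-pred a<1+b) λ a<q q≤b → free a<q (m≤n⇒m≤1+n q≤b)

primeCount-leastPrimeFrom : LeastPrimeFrom (suc a) b → primeCount b ≡ suc (primeCount a)
primeCount-leastPrimeFrom {a} {suc b} (pb , a<1+b , free) with prime? (suc b)
... | yes _   = cong suc (primeCount-PrimeFree (≤-pred a<1+b) free)
... | no  ¬pb = contradiction pb ¬pb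

primeCount-P : ∀ k → primeCount (P k) ≡ k
primeCount-P zero    = refl
primeCount-P (suc k) = trans (primeCount-leastPrimeFrom (P-least k)) (cong suc (primeCount-P k))

ω-primeDivisorsUpTo : PrimeDivisorsUpTo n B → B ≤ n → ω n ≡ primeCount B
ω-primeDivisorsUpTo {n} {B} divs B≤n = trans (count-above n B≤n) (count-below B ≤-refl)
  where
  count-below : ∀ d → d ≤ B → countPrimeDivisorsUpTo d n ≡ primeCount d
  count-below zero    _     = refl
  count-below (suc d) 1+d≤B with prime? (suc d) | suc d ∣? n
  ... | yes _  | yes _  = cong suc (count-below d (<⇒≤ 1+d≤B))
  ... | yes pd | no  ∤n = contradiction (from (divs pd) 1+d≤B) ∤n
  ... | no  _  | _      = count-below d (<⇒≤ 1+d≤B)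

  count-above : ∀ d → B ≤ d → countPrimeDivisorsUpTo d n ≡ countPrimeDivisorsUpTo B n
  count-above d B≤d with m≤n⇒m<n∨m≡n B≤d
  ... | inj₂ refl = refl
  count-above (suc d) _ | inj₁ B<1+d with prime? (suc d) | suc d ∣? n
  ... | yes pd | yes ∣n = contradiction (to (divs pd) ∣n) (<⇒≱ B<1+d)
  ... | yes _  | no  _  = count-above d (≤-pred B<1+d)
  ... | no  _  | _      = count-above d (≤-pred B<1+d)

α-suc : ∀ m x → 1 ≤ x → α (suc m) x ≡ iterate P x m
α-suc m x 1≤x = trans (ω-primeDivisorsUpTo divs B≤G) (primeCount-P (iterate P x m))
  where
  divs : PrimeDivisorsUpTo (genPrimorial (suc m) x) (P (iterate P x m))
  divs = genPrimorial-primeDivisors m x 1≤x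
  B≤G : P (iterate P x m) ≤ genPrimorial (suc m) x
  B≤G = ∣⇒≤ {{>-nonZero (genPrimorial-pos (suc m) x 1≤x)}}
          (from (divs (P-prime (iterate-preserves (1 ≤_) (λ {y} _ → 1≤P y) m 1≤x))) ≤-refl)

theorem6p6 : (x n : ℕ) → 1 ≤ x → 2 ≤ n → α n x ≡ P (α (n ∸ 1) x)
theorem6p6 x (suc (suc m)) 1≤x _ = begin
  α (suc (suc m)) x     ≡⟨ α-suc (suc m) x 1≤x ⟩
  iterate P (P x) m     ≡⟨ iterate-comm P x m ⟩
  P (iterate P x m)     ≡⟨ cong P (α-suc m x 1≤x) ⟨
  P (α (suc m) x)       ∎
  where open ≡-Reasoning
theorem6p6 x (suc zero) _ (s≤s ())
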